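{- Let $n>c_1>c_2\ge0$ and $\Sigma$ be natural numbers with $\Sigma$ even and $nc_1\ge\Sigma\ge nc_2$. The following are equivalent: (1) $\mathrm{LEG}(n,\Sigma,c_1,c_2)=(e_1,\dots,e_n)$ satisfies $\sum_{i=1}^k e_i\le k(k-1)+e_n(n-k)+1$ for all $k\in\{1,\dots,n\}$; (2) every $D=(d_1,\dots,d_n)\in\mathcal D(n,\Sigma,c_1,c_2)$ satisfies $\sum_{i=1}^k d_i\le k(k-1)+d_n(n-k)+1$ for all $k\in\{1,\dots,n\}$.
   Context: $\mathcal D(n,\Sigma,c_1,c_2)$ is the set of integer sequences $(d_1,\dots,d_n)$ with $c_1\ge d_1\ge\dots\ge d_n\ge c_2$, $\sum_i d_i$ even and $\sum_i d_i=\Sigma$. With $\alpha=\lfloor(\Sigma-nc_2)/(c_1-c_2)\rfloor$ and $a=\Sigma-(\alpha c_1+(n-1-\alpha)c_2)$, $\mathrm{LEG}(n,\Sigma,c_1,c_2)$ is the sequence consisting of $\alpha$ entries $c_1$, then $a$, then $n-1-\alpha$ entries $c_2$. -}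

module Defs where

open import Data.Nat using (ℕ; zero; suc; _+_; _*_; _∸_; _≤_; _<_; _≤?_; _≟_)
open import Data.Nat.DivMod using (_/_)
open import Data.Nat.Divisibility using (_∣_)
open import Data.Product using (_×_)
open import Relation.Nullary using (yes; no)
open import Relation.Binary.PropositionalEquality using (_≡_)

-- Sequences are functions ℕ → ℕ read 1-indexed: d 1, …, d n
-- (values outside 1..n are never used).

prefixSum : (ℕ → ℕ) → ℕ → ℕ
prefixSum d zero    = 0
prefixSum d (suc k) = prefixSum d k + d (suc k)

Even : ℕ → Set
Even m = 2 ∣ m

InD : ℕ → ℕ → ℕ → ℕ → (ℕ → ℕ) → Set
InD n S c₁ c₂ d =
  (d 1 ≤ c₁)
  × (∀ i → 1 ≤ i → i < n → d (suc i) ≤ d i)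
  × (c₂ ≤ d n)
  × Even (prefixSum d n)
  × (prefixSum d n ≡ S)

-- natural-number floor division; the divisor 0 case is never used
-- under the hypothesis c₂ < c₁
_div_ : ℕ → ℕ → ℕ
m div zero    = 0
m div (suc k) = m / suc k

legα : ℕ → ℕ → ℕ → ℕ → ℕ
legα n S c₁ c₂ = (S ∸ n * c₂) div (c₁ ∸ c₂)

-- a = Σ − (α c₁ + (n − 1 − α) c₂)
-- (exact subtraction whenever α ≤ n − 1, which is the only case where
--  a occurs among the n entries)
legA : ℕ → ℕ → ℕ → ℕ → ℕ
legA n S c₁ c₂ = S ∸ (α * c₁ + (n ∸ 1 ∸ α) * c₂)
  where α = legα n S c₁ c₂

LEG : ℕ → ℕ → ℕ → ℕ → (ℕ → ℕ)
LEG n S c₁ c₂ i with i ≤? legα n S c₁ c₂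
... | yes _ = c₁
... | no _ with i ≟ suc (legα n S c₁ c₂)
...   | yes _ = legA n S c₁ c₂
...   | no _  = c₂

Cond : ℕ → (ℕ → ℕ) → Set
Cond n d = ∀ k → 1 ≤ k → k ≤ n →
  prefixSum d k ≤ k * (k ∸ 1) + d n * (n ∸ k) + 1

{-# OPTIONS --safe #-}
module Submission where

-- LEG is the greatest element of 𝒟 for majorisation: its head of c₁'s
-- maximises every short prefix sum, and its tail of c₂'s forces every longer
-- prefix sum of another D ∈ 𝒟 to be at most LEG's, because both have total Σ
-- and D's remaining entries are at least c₂.  Comparing the prefixes of
-- length n − 1 then shows that LEG also has the smallest last entry.  The
-- bound k(k−1) + dₙ(n−k) + 1 only gets weaker as the prefix sum decreases
-- and dₙ increases, so (1) implies (2); conversely LEG itself lies in 𝒟.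

open import Defs
open import Data.Nat using (ℕ; zero; suc; _+_; _*_; _∸_; _≤_; _<_; _≤′_; ≤′-refl; ≤′-step; z≤n; s≤s; >-nonZero)
open import Data.Nat.DivMod using (_%_; m≡m%n+[m/n]*n; m%n<n)
open import Data.Nat.Properties
open import Data.Nat.Tactic.RingSolver using (solve-∀)
open import Data.Product using (_×_; _,_; ∃; ∃₂; proj₁; proj₂)
open import Data.Sum using (_⊎_; inj₁; inj₂)
open import Function using (const)
open import Function.Bundles using (_⇔_; mk⇔)
open import Relation.Binary using (tri<; tri≈; tri>)
open import Relation.Binary.PropositionalEquality using (_≡_; refl; sym; trans; cong; cong₂; subst; module ≡-Reasoning)
open import Relation.Nullary using (yes; no; contradiction)

prefixSum-cong : ∀ {f g} k → (∀ i → 1 ≤ i → i ≤ k → f i ≡ g i) → prefixSum f k ≡ prefixSum g k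
prefixSum-cong zero    f≡g = refl
prefixSum-cong (suc k) f≡g =
  cong₂ _+_ (prefixSum-cong k (λ i 1≤i i≤k → f≡g i 1≤i (m≤n⇒m≤1+n i≤k))) (f≡g (suc k) (s≤s z≤n) ≤-refl)

prefixSum-mono-≤ : ∀ {f g} k → (∀ i → 1 ≤ i → i ≤ k → f i ≤ g i) → prefixSum f k ≤ prefixSum g k
prefixSum-mono-≤ zero    f≤g = z≤n
prefixSum-mono-≤ (suc k) f≤g =
  +-mono-≤ (prefixSum-mono-≤ k (λ i 1≤i i≤k → f≤g i 1≤i (m≤n⇒m≤1+n i≤k))) (f≤g (suc k) (s≤s z≤n) ≤-refl)

prefixSum-const : ∀ c k → prefixSum (const c) k ≡ k * c
prefixSum-const c zero    = refl
prefixSum-const c (suc k) = trans (cong (_+ c) (prefixSum-const c k)) (+-comm (k * c) c)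

prefixSum-split : ∀ f j t → prefixSum f (t + j) ≡ prefixSum f j + prefixSum (λ i → f (i + j)) t
prefixSum-split f j zero    = sym (+-identityʳ _)
prefixSum-split f j (suc t) = trans (cong (_+ f (suc t + j)) (prefixSum-split f j t)) (+-assoc (prefixSum f j) _ _)

prefixSum-≡-* : ∀ {f c} k → (∀ i → 1 ≤ i → i ≤ k → f i ≡ c) → prefixSum f k ≡ k * c
prefixSum-≡-* {c = c} k f≡c = trans (prefixSum-cong k f≡c) (prefixSum-const c k)

prefixSum-≤-* : ∀ {f c} k → (∀ i → 1 ≤ i → i ≤ k → f i ≤ c) → prefixSum f k ≤ k * c
prefixSum-≤-* {c = c} k f≤c = ≤-trans (prefixSum-mono-≤ k f≤c) (≤-reflexive (prefixSum-const c k))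

*-≤-prefixSum : ∀ {f c} k → (∀ i → 1 ≤ i → i ≤ k → c ≤ f i) → k * c ≤ prefixSum f k
*-≤-prefixSum {c = c} k c≤f = ≤-trans (≤-reflexive (sym (prefixSum-const c k))) (prefixSum-mono-≤ k c≤f)

private
  shift-range : ∀ {i j t} → 1 ≤ i → i ≤ t → j < i + j × i + j ≤ t + j
  shift-range {j = j} 1≤i i≤t = +-monoˡ-≤ j 1≤i , +-monoˡ-≤ j i≤t

prefixSum-tail-≡ : ∀ {f c} j t → (∀ i → j < i → i ≤ t + j → f i ≡ c) →
  prefixSum f (t + j) ≡ prefixSum f j + t * c
prefixSum-tail-≡ {f} j t f≡c = trans (prefixSum-split f j t) (cong (prefixSum f j +_)
  (prefixSum-≡-* t (λ i 1≤i i≤t → let j<i+j , i+j≤t+j = shift-range 1≤i i≤t in f≡c (i + j) j<i+j i+j≤t+j)))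

prefixSum-tail-≥ : ∀ {f c} j t → (∀ i → j < i → i ≤ t + j → c ≤ f i) →
  prefixSum f j + t * c ≤ prefixSum f (t + j)
prefixSum-tail-≥ {f} j t c≤f = ≤-trans (+-monoʳ-≤ (prefixSum f j)
  (*-≤-prefixSum t (λ i 1≤i i≤t → let j<i+j , i+j≤t+j = shift-range 1≤i i≤t in c≤f (i + j) j<i+j i+j≤t+j)))
  (≤-reflexive (sym (prefixSum-split f j t)))

Antitone : ℕ → (ℕ → ℕ) → Set
Antitone n d = ∀ i → 1 ≤ i → i < n → d (suc i) ≤ d i

Bounded : ℕ → ℕ → ℕ → (ℕ → ℕ) → Set
Bounded n lo hi d = ∀ i → 1 ≤ i → i ≤ n → lo ≤ d i × d i ≤ hi

antitone-≤ : ∀ {n d i j} → Antitone n d → 1 ≤ i → i ≤ j → j ≤ n → d j ≤ d i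
antitone-≤ {n} {d} {i} anti 1≤i i≤j = go (≤⇒≤′ i≤j)
  where
  go : ∀ {j} → i ≤′ j → j ≤ n → d j ≤ d i
  go ≤′-refl             _   = ≤-refl
  go (≤′-step {j} i≤′j) j<n = ≤-trans (anti j (≤-trans 1≤i (≤′⇒≤ i≤′j)) j<n) (go i≤′j (<⇒≤ j<n))

InD⇒Bounded : ∀ {n S c₁ c₂ d} → InD n S c₁ c₂ d → Bounded n c₂ c₁ d
InD⇒Bounded (d₁≤c₁ , anti , c₂≤dₙ , _) i 1≤i i≤n =
  ≤-trans c₂≤dₙ (antitone-≤ anti 1≤i i≤n ≤-refl) , ≤-trans (antitone-≤ anti ≤-refl 1≤i i≤n) d₁≤c₁

Majorises : ℕ → (ℕ → ℕ) → (ℕ → ℕ) → Set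
Majorises n e d = (∀ k → k ≤ n → prefixSum d k ≤ prefixSum e k) × prefixSum d n ≡ prefixSum e n

Majorises⇒last-≤ : ∀ {m e d} → Majorises (suc m) e d → e (suc m) ≤ d (suc m)
Majorises⇒last-≤ {m} {e} {d} (prefix≤ , total) = +-cancelˡ-≤ (prefixSum d m) _ _ (begin
  prefixSum d m + e (suc m) ≤⟨ +-monoˡ-≤ (e (suc m)) (prefix≤ m (n≤1+n m)) ⟩
  prefixSum e (suc m)       ≡⟨ sym total ⟩
  prefixSum d (suc m)       ∎)
  where open ≤-Reasoning

Majorises⇒Cond : ∀ {n e d} → Majorises n e d → Cond n e → Cond n d
Majorises⇒Cond {zero} _ _ _ () z≤n
Majorises⇒Cond {suc m} {e} {d} maj@(prefix≤ , _) cond k 1≤k k≤n = begin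
  prefixSum d k                                   ≤⟨ prefix≤ k k≤n ⟩
  prefixSum e k                                   ≤⟨ cond k 1≤k k≤n ⟩
  k * (k ∸ 1) + e (suc m) * (suc m ∸ k) + 1       ≤⟨ +-monoˡ-≤ 1 (+-monoʳ-≤ (k * (k ∸ 1))
                                                       (*-monoˡ-≤ (suc m ∸ k) (Majorises⇒last-≤ maj))) ⟩
  k * (k ∸ 1) + d (suc m) * (suc m ∸ k) + 1       ∎
  where open ≤-Reasoning

record IsStep (e : ℕ → ℕ) (α hi lo : ℕ) : Set where
  field
    head : ∀ i → i ≤ α → e i ≡ hi
    tail : ∀ i → suc α < i → e i ≡ lo

module _ {e α hi lo} (step : IsStep e α hi lo) where
  open IsStep step

  IsStep-bounded : ∀ {n} → lo ≤ hi → (suc α ≤ n → lo ≤ e (suc α) × e (suc α) ≤ hi) → Bounded n lo hi e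
  IsStep-bounded lo≤hi mid i _ i≤n with <-cmp i (suc α)
  ... | tri< i<1+α _ _ = subst (λ x → lo ≤ x × x ≤ hi) (sym (head i (≤-pred i<1+α))) (lo≤hi , ≤-refl)
  ... | tri≈ _ refl _  = mid i≤n
  ... | tri> _ _ 1+α<i = subst (λ x → lo ≤ x × x ≤ hi) (sym (tail i 1+α<i)) (≤-refl , lo≤hi)

  IsStep-antitone : ∀ {n} → Bounded n lo hi e → Antitone n e
  IsStep-antitone bounded i 1≤i i<n with <-cmp i (suc α)
  ... | tri< i<1+α _ _ = ≤-trans (proj₂ (bounded (suc i) (s≤s z≤n) i<n)) (≤-reflexive (sym (head i (≤-pred i<1+α))))
  ... | tri≈ _ refl _  = ≤-trans (≤-reflexive (tail (suc i) ≤-refl)) (proj₁ (bounded i 1≤i (<⇒≤ i<n)))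
  ... | tri> _ _ 1+α<i = ≤-reflexive (trans (tail (suc i) (m<n⇒m<1+n 1+α<i)) (sym (tail i 1+α<i)))

  IsStep-prefixSum : ∀ m → prefixSum e (m + suc α) ≡ α * hi + e (suc α) + m * lo
  IsStep-prefixSum m = begin
    prefixSum e (m + suc α)                ≡⟨ prefixSum-tail-≡ (suc α) m (λ i 1+α<i _ → tail i 1+α<i) ⟩
    prefixSum e α + e (suc α) + m * lo     ≡⟨ cong (λ x → x + e (suc α) + m * lo) (prefixSum-≡-* α (λ i _ → head i)) ⟩
    α * hi + e (suc α) + m * lo            ∎
    where open ≡-Reasoning

  IsStep-majorises : ∀ {n d} → Bounded n lo hi d → prefixSum d n ≡ prefixSum e n → Majorises n e d
  IsStep-majorises {n} {d} bounded total = prefix≤ , total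
    where
    prefix≤ : ∀ k → k ≤ n → prefixSum d k ≤ prefixSum e k
    prefix≤ k k≤n with k ≤? α
    ... | yes k≤α = begin
      prefixSum d k ≤⟨ prefixSum-≤-* k (λ i 1≤i i≤k → proj₂ (bounded i 1≤i (≤-trans i≤k k≤n))) ⟩
      k * hi        ≡⟨ sym (prefixSum-≡-* k (λ i _ i≤k → head i (≤-trans i≤k k≤α))) ⟩
      prefixSum e k ∎
      where open ≤-Reasoning
    ... | no k≰α = +-cancelʳ-≤ (t * lo) (prefixSum d k) (prefixSum e k) (begin
      prefixSum d k + t * lo ≤⟨ prefixSum-tail-≥ k t (λ i k<i i≤t+k →
                                  proj₁ (bounded i (≤-trans (s≤s z≤n) k<i) (subst (i ≤_) t+k≡n i≤t+k))) ⟩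
      prefixSum d (t + k)    ≡⟨ cong (prefixSum d) t+k≡n ⟩
      prefixSum d n          ≡⟨ total ⟩
      prefixSum e n          ≡⟨ cong (prefixSum e) (sym t+k≡n) ⟩
      prefixSum e (t + k)    ≡⟨ prefixSum-tail-≡ k t (λ i k<i _ → tail i (≤-<-trans (≰⇒> k≰α) k<i)) ⟩
      prefixSum e k + t * lo ∎)
      where
      open ≤-Reasoning
      t = n ∸ k
      t+k≡n : t + k ≡ n
      t+k≡n = m∸n+n≡m k≤n

div-remainder : ∀ m k → 0 < k → ∃ λ r → r < k × m ≡ m div k * k + r
div-remainder m (suc k) _ = m % suc k , m%n<n m (suc k) , trans (m≡m%n+[m/n]*n m (suc k)) (+-comm (m % suc k) _)

quotient-≤⇒<⊎≡ : ∀ {α n q r} → r < q → α * q + r ≤ n * q → α < n ⊎ (α ≡ n × r ≡ 0)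
quotient-≤⇒<⊎≡ {α} {n} {q} {r} r<q αq+r≤nq with <-cmp α n
... | tri< α<n _ _ = inj₁ α<n
... | tri≈ _ refl _ =
  inj₂ (refl , n≤0⇒n≡0 (+-cancelˡ-≤ (α * q) r 0 (≤-trans αq+r≤nq (≤-reflexive (sym (+-identityʳ (α * q)))))))
... | tri> _ _ n<α =
  contradiction (*-cancelʳ-≤ α n q {{>-nonZero (≤-<-trans z≤n r<q)}} (≤-trans (m≤m+n (α * q) r) αq+r≤nq)) (<⇒≱ n<α)

step-decomposition : ∀ {n S c₁ c₂ q α r} → c₁ ≡ c₂ + q → r < q → S ≡ n * c₂ + (α * q + r) → S ≤ n * c₁ →
  (α ≡ n × S ≡ n * c₁) ⊎ ∃₂ λ m a → m + suc α ≡ n × c₂ ≤ a × a ≤ c₁ × S ≡ α * c₁ + a + m * c₂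
step-decomposition {n} {c₂ = c₂} {q} {α} {r} refl r<q refl S≤nc₁
  with quotient-≤⇒<⊎≡ {α} {n} r<q (+-cancelˡ-≤ (n * c₂) _ _ (≤-trans S≤nc₁ (≤-reflexive (*-distribˡ-+ n c₂ q))))
... | inj₂ (refl , refl) = inj₁ (refl , full α c₂ q)
  where
  full : ∀ n c₂ q → n * c₂ + (n * q + 0) ≡ n * (c₂ + q)
  full = solve-∀
... | inj₁ α<n = inj₂ (m , c₂ + r , m∸n+n≡m α<n , m≤m+n c₂ r , +-monoʳ-≤ c₂ (<⇒≤ r<q) ,
                      trans (cong (λ x → x * c₂ + (α * q + r)) (sym (m∸n+n≡m α<n))) (split m α c₂ q r))
  where
  m = n ∸ suc α
  split : ∀ m α c₂ q r → (m + suc α) * c₂ + (α * q + r) ≡ α * (c₂ + q) + (c₂ + r) + m * c₂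
  split = solve-∀

module _ {n S c₁ c₂ : ℕ} where
  private
    α = legα n S c₁ c₂
    e = LEG n S c₁ c₂

  LEG-head : ∀ i → i ≤ α → e i ≡ c₁
  LEG-head i i≤α with i ≤? α
  ... | yes _   = refl
  ... | no i≰α = contradiction i≤α i≰α

  LEG-tail : ∀ i → suc α < i → e i ≡ c₂
  LEG-tail i 1+α<i with i ≤? α
  ... | yes i≤α = contradiction (<-trans (n<1+n α) 1+α<i) (≤⇒≯ i≤α)
  ... | no _ with i ≟ suc α
  ...   | yes refl = contradiction 1+α<i (<-irrefl refl)
  ...   | no _     = refl

  LEG-isStep : IsStep e α c₁ c₂
  LEG-isStep = record { head = LEG-head ; tail = LEG-tail }

  LEG-mid : e (suc α) ≡ legA n S c₁ c₂
  LEG-mid with suc α ≤? α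
  ... | yes 1+α≤α = contradiction 1+α≤α (<-irrefl refl)
  ... | no _ with suc α ≟ suc α
  ...   | yes _   = refl
  ...   | no 1+α≢1+α = contradiction refl 1+α≢1+α

  legA-value : ∀ m a → m + suc α ≡ n → S ≡ α * c₁ + a + m * c₂ → legA n S c₁ c₂ ≡ a
  legA-value m a m+1+α≡n S≡ = begin
    S ∸ (α * c₁ + (n ∸ 1 ∸ α) * c₂)  ≡⟨ cong (λ x → S ∸ (α * c₁ + x * c₂)) n∸1∸α≡m ⟩
    S ∸ (α * c₁ + m * c₂)            ≡⟨ sym (∸-+-assoc S (α * c₁) (m * c₂)) ⟩
    S ∸ α * c₁ ∸ m * c₂              ≡⟨ cong (λ x → x ∸ α * c₁ ∸ m * c₂) (trans S≡ (+-assoc (α * c₁) a (m * c₂))) ⟩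
    α * c₁ + (a + m * c₂) ∸ α * c₁ ∸ m * c₂ ≡⟨ cong (_∸ m * c₂) (m+n∸m≡n (α * c₁) (a + m * c₂)) ⟩
    a + m * c₂ ∸ m * c₂              ≡⟨ m+n∸n≡m a (m * c₂) ⟩
    a                                ∎
    where
    open ≡-Reasoning
    n∸1∸α≡m : n ∸ 1 ∸ α ≡ m
    n∸1∸α≡m = trans (∸-+-assoc n 1 α) (trans (cong (_∸ suc α) (sym m+1+α≡n)) (m+n∸n≡m m (suc α)))

  legα-decomposition : c₂ < c₁ → n * c₂ ≤ S → S ≤ n * c₁ →
    (α ≡ n × S ≡ n * c₁) ⊎ ∃₂ λ m a → m + suc α ≡ n × c₂ ≤ a × a ≤ c₁ × S ≡ α * c₁ + a + m * c₂
  legα-decomposition c₂<c₁ nc₂≤S S≤nc₁ =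
    let r , r<q , T≡αq+r = div-remainder (S ∸ n * c₂) (c₁ ∸ c₂) (m<n⇒0<n∸m c₂<c₁)
    in step-decomposition (sym (m+[n∸m]≡n (<⇒≤ c₂<c₁))) r<q
         (trans (sym (m+[n∸m]≡n nc₂≤S)) (cong (n * c₂ +_) T≡αq+r)) S≤nc₁

  module _ (c₂<c₁ : c₂ < c₁) (nc₂≤S : n * c₂ ≤ S) (S≤nc₁ : S ≤ n * c₁) where

    LEG-bounded : Bounded n c₂ c₁ e
    LEG-bounded = IsStep-bounded LEG-isStep (<⇒≤ c₂<c₁) mid
      where
      mid : suc α ≤ n → c₂ ≤ e (suc α) × e (suc α) ≤ c₁
      mid α<n with legα-decomposition c₂<c₁ nc₂≤S S≤nc₁
      ... | inj₁ (α≡n , _) = contradiction α<n (<-irrefl α≡n)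
      ... | inj₂ (m , a , m+1+α≡n , c₂≤a , a≤c₁ , S≡) =
        subst (λ x → c₂ ≤ x × x ≤ c₁) (sym (trans LEG-mid (legA-value m a m+1+α≡n S≡))) (c₂≤a , a≤c₁)

    LEG-sum : prefixSum e n ≡ S
    LEG-sum with legα-decomposition c₂<c₁ nc₂≤S S≤nc₁
    ... | inj₁ (α≡n , S≡nc₁) =
      trans (prefixSum-≡-* n (λ i _ i≤n → LEG-head i (≤-trans i≤n (≤-reflexive (sym α≡n))))) (sym S≡nc₁)
    ... | inj₂ (m , a , m+1+α≡n , _ , _ , S≡) = begin
      prefixSum e n                  ≡⟨ cong (prefixSum e) (sym m+1+α≡n) ⟩
      prefixSum e (m + suc α)        ≡⟨ IsStep-prefixSum LEG-isStep m ⟩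
      α * c₁ + e (suc α) + m * c₂    ≡⟨ cong (λ x → α * c₁ + x + m * c₂) (trans LEG-mid (legA-value m a m+1+α≡n S≡)) ⟩
      α * c₁ + a + m * c₂            ≡⟨ sym S≡ ⟩
      S                              ∎
      where open ≡-Reasoning

    LEG∈D : 1 ≤ n → Even S → InD n S c₁ c₂ e
    LEG∈D 1≤n even-S =
      proj₂ (LEG-bounded 1 ≤-refl 1≤n) , IsStep-antitone LEG-isStep LEG-bounded ,
      proj₁ (LEG-bounded n 1≤n ≤-refl) , subst Even (sym LEG-sum) even-S , LEG-sum

theorem4p6 : (n S c₁ c₂ : ℕ) → c₂ < c₁ → c₁ < n → Even S →
    S ≤ n * c₁ → n * c₂ ≤ S →
    Cond n (LEG n S c₁ c₂) ⇔ (∀ d → InD n S c₁ c₂ d → Cond n d)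
theorem4p6 n S c₁ c₂ c₂<c₁ c₁<n even-S S≤nc₁ nc₂≤S = mk⇔
  (λ cond-LEG d d∈D → Majorises⇒Cond (LEG-majorises d∈D) cond-LEG)
  (λ cond-D → cond-D (LEG n S c₁ c₂) (LEG∈D c₂<c₁ nc₂≤S S≤nc₁ (≤-trans (s≤s z≤n) c₁<n) even-S))
  where
  LEG-majorises : ∀ {d} → InD n S c₁ c₂ d → Majorises n (LEG n S c₁ c₂) d
  LEG-majorises d∈D@(_ , _ , _ , _ , sum-d≡S) =
    IsStep-majorises LEG-isStep (InD⇒Bounded d∈D) (trans sum-d≡S (sym (LEG-sum {n} c₂<c₁ nc₂≤S S≤nc₁)))
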